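{- Let $q\ge 2$ and $n\ge 1$ be integers, let $h\in\{0,1,\ldots,n\}$ and $\lambda=\lambda_h=(q-1)n-qh$ (so $h=\frac{(q-1)n-\lambda}{q}$). Let $f:\mathbb{F}_q^n\to\mathbb{C}$ be any function satisfying $\sum_{\beta\in W_1(\alpha)} f(\beta)=\lambda f(\alpha)$ for all $\alpha\in\mathbb{F}_q^n$ (a $\lambda$-function), let $\alpha\in\mathbb{F}_q^n$, and let $I\subseteq\{1,\ldots,n\}$ with $\overline{I}=\{1,\ldots,n\}\setminus I$. Then, as an identity of rational functions in the variables $x,y$, $$(x+(q-1)y)^{h-|\overline{I}|}\, g^{\overline{I},\alpha}_f(x,y) = (x'+(q-1)y')^{h-|I|}\, g^{I,\alpha}_f(x',y'),$$ where $x'=x+(q-2)y$ and $y'=-y$.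
   Context: $\mathbb{F}_q=\{0,1,\ldots,q-1\}$ is the additive group of integers modulo $q$ and $\mathbb{F}_q^n$ its $n$-fold direct product; the $q$-ary $n$-dimensional hypercube is the graph on $\mathbb{F}_q^n$ in which two vertices are adjacent iff they differ in exactly one coordinate. For $\alpha\in\mathbb{F}_q^n$, $s(\alpha)$ is the set of nonzero coordinates of $\alpha$ (its support), and the Hamming distance $\rho(\alpha,\beta)=|s(\alpha-\beta)|$. $W_j(\alpha)$ is the set of vertices at Hamming distance exactly $j$ from $\alpha$. For $I\subseteq\{1,\ldots,n\}$, the face $\Gamma_I(\alpha)=\{\beta\in\mathbb{F}_q^n:\beta_i=\alpha_i\ \forall i\notin I\}$. For a function $f:\mathbb{F}_q^n\to\mathbb{C}$, the $(I,\alpha)$-local weight enumerator of $f$ is the polynomial $$g^{I,\alpha}_f(x,y)=\sum_{\beta\in\Gamma_I(\alpha)} f(\beta)\, y^{|s(\beta-\alpha)|}\,x^{|I|-|s(\beta-\alpha)|}.$$ -}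

module Defs where

open import Level using (Level)
open import Data.Nat using (ℕ; zero; suc; _∸_)
open import Data.Bool using (Bool; true; false; not; _∧_; if_then_else_)
open import Data.Fin using (Fin; zero; suc)
open import Data.Fin.Subset using (Subset)
open import Data.Vec using (lookup)
open import Data.List using (List; []; _∷_; map; concatMap; filter; foldr)
open import Data.Fin.Properties using (_≟_)
open import Relation.Nullary.Decidable using (⌊_⌋)
open import Algebra.Bundles using (CommutativeRing)

-- Points of F_q^n: functions Fin n → Fin q (F_q = Z/qZ as a set; only
-- equality of coordinates is used below).
Pt : ℕ → ℕ → Set
Pt q n = Fin n → Fin q

allFin : (q : ℕ) → List (Fin q)
allFin zero = []
allFin (suc q) = zero ∷ map suc (allFin q)

cons : ∀ {q n} → Fin q → Pt q n → Pt q (suc n)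
cons a v zero = a
cons a v (suc i) = v i

allPts : (q n : ℕ) → List (Pt q n)
allPts q zero = (λ ()) ∷ []
allPts q (suc n) = concatMap (λ a → map (cons a) (allPts q n)) (allFin q)

countB : (n : ℕ) → (Fin n → Bool) → ℕ
countB zero P = 0
countB (suc n) P = (if P zero then 1 else 0) Data.Nat.+ countB n (λ i → P (suc i))

dist : ∀ {q n} → Pt q n → Pt q n → ℕ
dist {q} {n} α β = countB n (λ i → not ⌊ α i ≟ β i ⌋)

allB : (n : ℕ) → (Fin n → Bool) → Bool
allB zero P = true
allB (suc n) P = P zero ∧ allB n (λ i → P (suc i))

inFace : ∀ {q n} → Subset n → Pt q n → Pt q n → Bool
inFace {q} {n} I α β = allB n (λ i → if lookup I i then true else ⌊ β i ≟ α i ⌋)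

module WithRing {c ℓ : Level} (R : CommutativeRing c ℓ) where
  open CommutativeRing R

  sumR : List Carrier → Carrier
  sumR = foldr _+_ 0#

  natR : ℕ → Carrier
  natR zero = 0#
  natR (suc m) = 1# + natR m

  pow : Carrier → ℕ → Carrier
  pow r zero = 1#
  pow r (suc m) = r * pow r m

  -- R has no additive torsion (true e.g. for ℂ)
  TorsionFree : Set (c Level.⊔ ℓ)
  TorsionFree = ∀ (m : ℕ) (r : Carrier) → natR (suc m) * r ≈ 0# → r ≈ 0#

  IsLambdaFunction : ∀ {q n} → Carrier → (Pt q n → Carrier) → Set ℓ
  IsLambdaFunction {q} {n} lam f =
    ∀ (α : Pt q n) →
      sumR (map f (filter (λ β → dist α β Data.Nat.≟ 1) (allPts q n))) ≈ lam * f α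

  localWE : ∀ {q n} → (Pt q n → Carrier) → Subset n → Pt q n → Carrier → Carrier → Carrier
  localWE {q} {n} f I α x y =
    sumR (map (λ β → f β * pow y (dist β α) * pow x (Data.Fin.Subset.∣ I ∣ ∸ dist β α))
              (filter (λ β → inFace I α β Data.Bool.≟ true) (allPts q n)))

module Submission where

open import Defs
open import Level using (Level)
open import Data.Nat using (ℕ; _≤_; _∸_) renaming (_*_ to _*ℕ_)
open import Data.Fin.Subset using (Subset; ∁; ∣_∣; _∩_; _─_)
open import Algebra.Bundles using (CommutativeRing; RawRing)

open import Data.Nat as ℕ using (zero; suc; z≤n; s≤s)
import Data.Nat.Properties as ℕP
open import Data.Bool using (Bool; true; false; not; _∧_; if_then_else_)
open import Data.Fin using (Fin; zero; suc)
open import Data.Fin.Properties using (_≟_)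
open import Data.Vec using ([]; _∷_; lookup)
open import Data.List using (List; []; _∷_; map; filter; _++_; concat; length)
open import Data.List.Properties using (length-map)
open import Data.Product using (_×_; _,_)
open import Data.Maybe using (Maybe; just; nothing)
open import Data.Empty using (⊥-elim; ⊥-elim-irr)
open import Relation.Nullary using (yes; no; ¬_)
open import Relation.Nullary.Decidable using (Dec; ⌊_⌋)
open import Relation.Binary.PropositionalEquality as ≡ using (_≡_)
import Algebra.Solver.Ring.AlmostCommutativeRing as ACR

-- The proof is a Fourier decomposition.  Every t : F_q^n → R splits as
--   q^n · t = Σ_{S ⊆ [n]} component S t,
-- where the S-component takes, coordinatewise, the sum over the coordinate
-- (for i ∉ S) or q·t minus that sum (for i ∈ S).  Each component is an
-- eigenvector of the adjacency operator A of the Hamming graph with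
-- eigenvalue λ_{|S|} = (q-1)n - q|S|; hence, R being torsion-free, a
-- λ_h-function has only components with |S| = h.  The (J,α)-local weight
-- enumerator of a single component factorises coordinatewise as
--   component S t (α) · (x + (q-1)y)^{|J ∖ S|} · (x - y)^{|J ∩ S|}.
-- For |S| = h the two sides of the theorem then carry the same monomials in
-- u = x + (q-1)y and v = x - y, using x′ + (q-1)y′ = v and x′ - y′ = u.

-- (b ∸ a) + a and (a ∸ b) + b both equal the maximum of a and b.
∸-balance : ∀ a b → (b ∸ a) ℕ.+ a ≡ (a ∸ b) ℕ.+ b
∸-balance zero    zero    = ≡.refl
∸-balance zero    (suc b) = ℕP.+-identityʳ (suc b)
∸-balance (suc a) zero    = ≡.sym (ℕP.+-identityʳ (suc a))
∸-balance (suc a) (suc b) = begin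
  (b ∸ a) ℕ.+ suc a   ≡⟨ ℕP.+-suc (b ∸ a) a ⟩
  suc ((b ∸ a) ℕ.+ a) ≡⟨ ≡.cong suc (∸-balance a b) ⟩
  suc ((a ∸ b) ℕ.+ b) ≡⟨ ℕP.+-suc (a ∸ b) b ⟨
  (a ∸ b) ℕ.+ suc b   ∎
  where open ≡.≡-Reasoning

-- Exponent bookkeeping of the final step: with k = a + b and h = b + c,
-- (h ∸ k) + a = (k ∸ h) + c.
exponent-balance : ∀ a b c → ((b ℕ.+ c) ∸ (a ℕ.+ b)) ℕ.+ a ≡ ((a ℕ.+ b) ∸ (b ℕ.+ c)) ℕ.+ c
exponent-balance a b c
  rewrite ℕP.+-comm a b | ℕP.[m+n]∸[m+o]≡n∸o b c a | ℕP.[m+n]∸[m+o]≡n∸o b a c = ∸-balance a c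

split-size : ∀ {n} (J S : Subset n) → ∣ J ─ S ∣ ℕ.+ ∣ J ∩ S ∣ ≡ ∣ J ∣
split-size []          []          = ≡.refl
split-size (true ∷ J)  (false ∷ S) = ≡.cong suc (split-size J S)
split-size (true ∷ J)  (true ∷ S)  = ≡.trans (ℕP.+-suc ∣ J ─ S ∣ ∣ J ∩ S ∣) (≡.cong suc (split-size J S))
split-size (false ∷ J) (false ∷ S) = split-size J S
split-size (false ∷ J) (true ∷ S)  = split-size J S

complement-split : ∀ {n} (I S : Subset n) → ∣ ∁ I ∩ S ∣ ℕ.+ ∣ I ∩ S ∣ ≡ ∣ S ∣
complement-split []          []          = ≡.refl
complement-split (true ∷ I)  (false ∷ S) = complement-split I S
complement-split (true ∷ I)  (true ∷ S)  = ≡.trans (ℕP.+-suc ∣ ∁ I ∩ S ∣ ∣ I ∩ S ∣) (≡.cong suc (complement-split I S))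
complement-split (false ∷ I) (false ∷ S) = complement-split I S
complement-split (false ∷ I) (true ∷ S)  = ≡.cong suc (complement-split I S)

-- Elementary arithmetic in a commutative ring: the embedding of ℕ, powers,
-- and a ring solver whose coefficients are formal differences of naturals
-- (so that it can cancel terms such as x - x), used for routine algebra.
module RingArithmetic {c ℓ : Level} (R : CommutativeRing c ℓ) where
  open CommutativeRing R hiding (zero)
  open WithRing R
  open import Relation.Binary.Reasoning.Setoid setoid
  open import Algebra.Properties.Ring ring using (-‿distribˡ-*; -‿distribʳ-*; -‿involutive; -0#≈0#; +-cancelˡ; x[y-z]≈xy-xz)
  open import Algebra.Properties.AbelianGroup +-abelianGroup using (⁻¹-∙-comm; x∙y⁻¹≈ε⇒x≈y; x≈y⇒x∙y⁻¹≈ε)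
  open import Algebra.Properties.CommutativeSemigroup +-commutativeSemigroup using (interchange)

  natR-+ : ∀ m n → natR (m ℕ.+ n) ≈ natR m + natR n
  natR-+ zero    n = sym (+-identityˡ _)
  natR-+ (suc m) n = trans (+-congˡ (natR-+ m n)) (sym (+-assoc _ _ _))

  natR-* : ∀ m n → natR (m ℕ.* n) ≈ natR m * natR n
  natR-* zero    n = sym (zeroˡ _)
  natR-* (suc m) n = begin
    natR (n ℕ.+ m ℕ.* n)          ≈⟨ natR-+ n (m ℕ.* n) ⟩
    natR n + natR (m ℕ.* n)       ≈⟨ +-cong (sym (*-identityˡ _)) (natR-* m n) ⟩
    1# * natR n + natR m * natR n ≈⟨ distribʳ _ _ _ ⟨
    (1# + natR m) * natR n        ∎

  pow-cong : ∀ {a b} m → a ≈ b → pow a m ≈ pow b m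
  pow-cong zero    e = refl
  pow-cong (suc m) e = *-cong e (pow-cong m e)

  pow-+ : ∀ r m k → pow r (m ℕ.+ k) ≈ pow r m * pow r k
  pow-+ r zero    k = sym (*-identityˡ _)
  pow-+ r (suc m) k = trans (*-congˡ (pow-+ r m k)) (sym (*-assoc _ _ _))

  neg-+ : ∀ a b → - (a + b) ≈ - a + - b
  neg-+ a b = sym (⁻¹-∙-comm a b)

  natR-suc-* : ∀ m x → natR (suc m) * x ≈ x + natR m * x
  natR-suc-* m x = trans (distribʳ x 1# (natR m)) (+-congʳ (*-identityˡ x))

  natR-*-injective : TorsionFree → ∀ m m′ x → ¬ (m ≡ m′) → natR m * x ≈ natR m′ * x → x ≈ 0#
  natR-*-injective tf zero    zero     x m≢m′ e = ⊥-elim (m≢m′ ≡.refl)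
  natR-*-injective tf zero    (suc m′) x m≢m′ e = tf m′ x (trans (sym e) (zeroˡ x))
  natR-*-injective tf (suc m) zero     x m≢m′ e = tf m x (trans e (zeroˡ x))
  natR-*-injective tf (suc m) (suc m′) x m≢m′ e = natR-*-injective tf m m′ x (λ m≡m′ → m≢m′ (≡.cong suc m≡m′))
    (+-cancelˡ x _ _ (trans (sym (natR-suc-* m x)) (trans e (natR-suc-* m′ x))))

  natR-*-cancel : TorsionFree → ∀ m .{{_ : ℕ.NonZero m}} {a b} → natR m * a ≈ natR m * b → a ≈ b
  natR-*-cancel tf zero    {{m≢0}} e = ⊥-elim-irr (ℕ.NonZero.nonZero m≢0)
  natR-*-cancel tf (suc m)         e = x∙y⁻¹≈ε⇒x≈y _ _ (tf m _ (trans (x[y-z]≈xy-xz _ _ _) (x≈y⇒x∙y⁻¹≈ε e)))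


  Differences : RawRing _ _
  Differences = record
    { Carrier = ℕ × ℕ ; _≈_ = _≡_
    ; _+_ = λ { (a , b) (c , d) → (a ℕ.+ c , b ℕ.+ d) }
    ; _*_ = λ { (a , b) (c , d) → (a ℕ.* c ℕ.+ b ℕ.* d , a ℕ.* d ℕ.+ b ℕ.* c) }
    ; -_  = λ { (a , b) → (b , a) }
    ; 0#  = (0 , 0) ; 1# = (1 , 0) }

  ⟦_⟧ᵈ : ℕ × ℕ → Carrier
  ⟦ a , b ⟧ᵈ = natR a - natR b

  private
    mul-differences : ∀ a b c d → (a - b) * (c - d) ≈ (a * c + b * d) - (a * d + b * c)
    mul-differences a b c d = begin
      (a - b) * (c - d)                         ≈⟨ distribʳ (c - d) a (- b) ⟩
      a * (c - d) + - b * (c - d)               ≈⟨ +-cong (distribˡ a c (- d)) (distribˡ (- b) c (- d)) ⟩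
      (a * c + a * - d) + (- b * c + - b * - d) ≈⟨ +-cong (+-congˡ (sym (-‿distribʳ-* a d))) (+-cong (sym (-‿distribˡ-* b c)) neg-neg) ⟩
      (a * c - a * d) + (- (b * c) + b * d)     ≈⟨ +-congˡ (+-comm _ _) ⟩
      (a * c - a * d) + (b * d - b * c)         ≈⟨ interchange _ _ _ _ ⟩
      (a * c + b * d) + (- (a * d) + - (b * c)) ≈⟨ +-congˡ (neg-+ _ _) ⟨
      (a * c + b * d) - (a * d + b * c)         ∎
      where
        neg-neg : - b * - d ≈ b * d
        neg-neg = trans (sym (-‿distribˡ-* b (- d))) (trans (-‿cong (sym (-‿distribʳ-* b d))) (-‿involutive _))

    difference-eq : ∀ a b c d → a + d ≈ b + c → a - b ≈ c - d
    difference-eq a b c d e = begin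
      a - b               ≈⟨ +-identityʳ _ ⟨
      (a - b) + 0#        ≈⟨ +-congˡ (-‿inverseʳ d) ⟨
      (a - b) + (d - d)   ≈⟨ interchange _ _ _ _ ⟩
      (a + d) + (- b - d) ≈⟨ +-congʳ e ⟩
      (b + c) + (- b - d) ≈⟨ interchange _ _ _ _ ⟩
      (b - b) + (c - d)   ≈⟨ +-congʳ (-‿inverseʳ b) ⟩
      0# + (c - d)        ≈⟨ +-identityˡ _ ⟩
      c - d               ∎

    natR-sum : ∀ a b c d → natR (a ℕ.* c ℕ.+ b ℕ.* d) ≈ natR a * natR c + natR b * natR d
    natR-sum a b c d = trans (natR-+ (a ℕ.* c) (b ℕ.* d)) (+-cong (natR-* a c) (natR-* b d))

  differences-homo : Differences ACR.-Raw-AlmostCommutative⟶ ACR.fromCommutativeRing R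
  differences-homo = record
    { ⟦_⟧    = ⟦_⟧ᵈ
    ; +-homo = λ { (a , b) (c , d) → begin
        natR (a ℕ.+ c) - natR (b ℕ.+ d)            ≈⟨ +-cong (natR-+ a c) (-‿cong (natR-+ b d)) ⟩
        (natR a + natR c) + - (natR b + natR d)    ≈⟨ +-congˡ (neg-+ _ _) ⟩
        (natR a + natR c) + (- natR b + - natR d)  ≈⟨ interchange _ _ _ _ ⟩
        (natR a - natR b) + (natR c - natR d)      ∎ }
    ; *-homo = λ { (a , b) (c , d) → trans (+-cong (natR-sum a b c d) (-‿cong (natR-sum a b d c)))
                                            (sym (mul-differences _ _ _ _)) }
    ; -‿homo = λ { (a , b) → begin
        natR b - natR a           ≈⟨ +-comm _ _ ⟩
        - natR a + natR b         ≈⟨ +-congˡ (-‿involutive _) ⟨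
        - natR a + - - natR b     ≈⟨ neg-+ _ _ ⟨
        - (natR a - natR b)       ∎ }
    ; 0-homo = -‿inverseʳ 0#
    ; 1-homo = trans (+-congʳ (+-identityʳ 1#)) (trans (+-congˡ -0#≈0#) (+-identityʳ 1#)) }

  differences-≟ : ∀ x y → Maybe (⟦ x ⟧ᵈ ≈ ⟦ y ⟧ᵈ)
  differences-≟ (a , b) (c , d) with a ℕ.+ d ℕP.≟ b ℕ.+ c
  ... | yes e = just (difference-eq _ _ _ _ (trans (sym (natR-+ a d)) (trans (reflexive (≡.cong natR e)) (natR-+ b c))))
  ... | no _  = nothing

  open import Algebra.Solver.Ring Differences (ACR.fromCommutativeRing R) differences-homo differences-≟ public
    using (solve; _:=_; _:+_; _:*_; _:-_; :-_)

  substitution-sum : ∀ r x y → (x + natR r * y) + natR (suc r) * (- y) ≈ x - y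
  substitution-sum r x y = trans (+-congˡ (natR-suc-* r (- y)))
    (solve 3 (λ x k y → (x :+ k :* y) :+ ((:- y) :+ k :* (:- y)) := x :- y) refl x (natR r) y)

  substitution-difference : ∀ r x y → (x + natR r * y) - (- y) ≈ x + natR (suc r) * y
  substitution-difference r x y = trans (solve 3 (λ x k y → (x :+ k :* y) :- (:- y) := x :+ (y :+ k :* y)) refl x (natR r) y)
    (+-congˡ (sym (natR-suc-* r y)))

module ListSums {c ℓ : Level} (R : CommutativeRing c ℓ) where
  open CommutativeRing R hiding (zero)
  open WithRing R
  open RingArithmetic R using (neg-+; solve; _:=_; _:+_; _:-_)
  open import Algebra.Properties.Ring ring using (-0#≈0#)
  open import Algebra.Properties.CommutativeSemigroup +-commutativeSemigroup using (interchange; x∙yz≈y∙xz)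
  open import Relation.Binary.Reasoning.Setoid setoid

  module _ {A : Set} where
    sum-cong : ∀ (g h : A → Carrier) (xs : List A) → (∀ x → g x ≈ h x) → sumR (map g xs) ≈ sumR (map h xs)
    sum-cong g h []       e = refl
    sum-cong g h (x ∷ xs) e = +-cong (e x) (sum-cong g h xs e)

    sum-+ : ∀ (g h : A → Carrier) (xs : List A) → sumR (map (λ x → g x + h x) xs) ≈ sumR (map g xs) + sumR (map h xs)
    sum-+ g h []       = sym (+-identityˡ _)
    sum-+ g h (x ∷ xs) = trans (+-congˡ (sum-+ g h xs)) (interchange _ _ _ _)

    sum-neg : ∀ (g : A → Carrier) (xs : List A) → sumR (map (λ x → - g x) xs) ≈ - sumR (map g xs)
    sum-neg g []       = sym -0#≈0#
    sum-neg g (x ∷ xs) = trans (+-congˡ (sum-neg g xs)) (sym (neg-+ _ _))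

    sum-*ˡ : ∀ (k : Carrier) (g : A → Carrier) (xs : List A) → sumR (map (λ x → k * g x) xs) ≈ k * sumR (map g xs)
    sum-*ˡ k g []       = sym (zeroʳ k)
    sum-*ˡ k g (x ∷ xs) = trans (+-congˡ (sum-*ˡ k g xs)) (sym (distribˡ _ _ _))

    sum-zero : ∀ (xs : List A) → sumR (map (λ _ → 0#) xs) ≈ 0#
    sum-zero []       = refl
    sum-zero (x ∷ xs) = trans (+-identityˡ _) (sum-zero xs)

    sum-const : ∀ (k : Carrier) (xs : List A) → sumR (map (λ _ → k) xs) ≈ natR (length xs) * k
    sum-const k []       = sym (zeroˡ k)
    sum-const k (x ∷ xs) = trans (+-cong (sym (*-identityˡ k)) (sum-const k xs)) (sym (distribʳ _ _ _))

    sum-++ : ∀ (g : A → Carrier) (xs ys : List A) → sumR (map g (xs ++ ys)) ≈ sumR (map g xs) + sumR (map g ys)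
    sum-++ g []       ys = sym (+-identityˡ _)
    sum-++ g (x ∷ xs) ys = trans (+-congˡ (sum-++ g xs ys)) (sym (+-assoc _ _ _))

    sum-filter : ∀ {p} {P : A → Set p} (P? : ∀ x → Dec (P x)) (g : A → Carrier) (xs : List A) →
      sumR (map g (filter P? xs)) ≈ sumR (map (λ x → if ⌊ P? x ⌋ then g x else 0#) xs)
    sum-filter P? g []       = refl
    sum-filter P? g (x ∷ xs) with P? x
    ... | yes _ = +-congˡ (sum-filter P? g xs)
    ... | no _  = trans (sum-filter P? g xs) (sym (+-identityˡ _))

  sum-map : ∀ {A B : Set} (g : B → Carrier) (f : A → B) (xs : List A) →
    sumR (map g (map f xs)) ≡ sumR (map (λ x → g (f x)) xs)
  sum-map g f []       = ≡.refl
  sum-map g f (x ∷ xs) = ≡.cong (g (f x) +_) (sum-map g f xs)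

  sum-concat : ∀ {A B : Set} (g : B → Carrier) (f : A → List B) (xs : List A) →
    sumR (map g (concat (map f xs))) ≈ sumR (map (λ a → sumR (map g (f a))) xs)
  sum-concat g f []       = refl
  sum-concat g f (x ∷ xs) = trans (sum-++ g (f x) _) (+-congˡ (sum-concat g f xs))

  select : ∀ {m} (a : Fin m) (X Y : Fin m → Carrier) →
    sumR (map (λ b → if ⌊ b ≟ a ⌋ then X b else Y b) (allFin m)) ≈ (X a - Y a) + sumR (map Y (allFin m))
  select {suc m} zero X Y = begin
    X zero + sumR (map (λ b → if ⌊ b ≟ zero ⌋ then X b else Y b) (map suc (allFin m)))
      ≈⟨ +-congˡ (reflexive (sum-map _ suc (allFin m))) ⟩
    X zero + sumR (map (λ b → Y (suc b)) (allFin m))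
      ≈⟨ solve 3 (λ a b s → a :+ s := (a :- b) :+ (b :+ s)) refl (X zero) (Y zero) _ ⟩
    (X zero - Y zero) + (Y zero + sumR (map (λ b → Y (suc b)) (allFin m)))
      ≈⟨ +-congˡ (+-congˡ (reflexive (≡.sym (sum-map Y suc (allFin m))))) ⟩
    (X zero - Y zero) + (Y zero + sumR (map Y (map suc (allFin m)))) ∎
  select {suc m} (suc a) X Y = begin
    Y zero + sumR (map (λ b → if ⌊ b ≟ suc a ⌋ then X b else Y b) (map suc (allFin m)))
      ≈⟨ +-congˡ (trans (reflexive (sum-map _ suc (allFin m)))
                        (sum-cong _ _ (allFin m) (λ b → reflexive (≡.cong (λ z → if z then X (suc b) else Y (suc b)) (suc-≟ b a))))) ⟩
    Y zero + sumR (map (λ b → if ⌊ b ≟ a ⌋ then X (suc b) else Y (suc b)) (allFin m))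
      ≈⟨ +-congˡ (select a (λ b → X (suc b)) (λ b → Y (suc b))) ⟩
    Y zero + ((X (suc a) - Y (suc a)) + sumR (map (λ b → Y (suc b)) (allFin m)))
      ≈⟨ x∙yz≈y∙xz _ _ _ ⟩
    (X (suc a) - Y (suc a)) + (Y zero + sumR (map (λ b → Y (suc b)) (allFin m)))
      ≈⟨ +-congˡ (+-congˡ (reflexive (≡.sym (sum-map Y suc (allFin m))))) ⟩
    (X (suc a) - Y (suc a)) + (Y zero + sumR (map Y (map suc (allFin m)))) ∎
    where
      suc-≟ : ∀ {m} (b a : Fin m) → ⌊ suc b ≟ suc a ⌋ ≡ ⌊ b ≟ a ⌋
      suc-≟ b a with b ≟ a
      ... | yes _ = ≡.refl
      ... | no _  = ≡.refl

  select′ : ∀ {m} (a : Fin m) (X Y : Fin m → Carrier) →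
    sumR (map (λ b → if ⌊ a ≟ b ⌋ then X b else Y b) (allFin m)) ≈ (X a - Y a) + sumR (map Y (allFin m))
  select′ {m} a X Y = trans (sum-cong _ _ (allFin m) (λ b → reflexive (≡.cong (λ z → if z then X b else Y b) (≟-sym a b))))
                        (select a X Y)
    where
      ≟-sym : ∀ {m} (a b : Fin m) → ⌊ a ≟ b ⌋ ≡ ⌊ b ≟ a ⌋
      ≟-sym a b with a ≟ b | b ≟ a
      ... | yes _  | yes _ = ≡.refl
      ... | no _   | no _  = ≡.refl
      ... | yes e  | no ne = ⊥-elim (ne (≡.sym e))
      ... | no ne  | yes e = ⊥-elim (ne (≡.sym e))

  select-zero : ∀ {A : Set} (X : Carrier) (xs : List A) → (X - 0#) + sumR (map (λ _ → 0#) xs) ≈ X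
  select-zero X xs = trans (+-cong (trans (+-congˡ -0#≈0#) (+-identityʳ _)) (sum-zero xs)) (+-identityʳ _)

-- Functions on the q-ary hypercube F_q^n, q = p + 1 ≥ 1, with values in R.
module Hypercube {c ℓ : Level} (R : CommutativeRing c ℓ) (p : ℕ) where
  open CommutativeRing R hiding (zero)
  open WithRing R
  open RingArithmetic R
  open ListSums R
  open import Relation.Binary.Reasoning.Setoid setoid
  open import Algebra.Properties.Ring ring using (-1*x≈-x; [y-z]x≈yx-zx)
  open import Algebra.Properties.CommutativeSemigroup *-commutativeSemigroup using (x∙yz≈y∙xz)

  q : ℕ
  q = suc p

  sumF : (Fin q → Carrier) → Carrier
  sumF g = sumR (map g (allFin q))

  length-allFin : ∀ m → length (allFin m) ≡ m
  length-allFin zero    = ≡.refl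
  length-allFin (suc m) = ≡.cong suc (≡.trans (length-map suc (allFin m)) (length-allFin m))

  sumF-const : ∀ k → sumF (λ _ → k) ≈ natR q * k
  sumF-const k = trans (sum-const k (allFin q)) (*-congʳ (reflexive (≡.cong natR (length-allFin q))))

  -- Pt q n is a function type, so pointwise equal points need not be
  -- definitionally equal; 'canonical' rebuilds a point coordinate by coordinate
  -- and everything below is expressed through canonical points.
  origin : Pt q 0
  origin = head (allPts q 0)
    where
      head : List (Pt q 0) → Pt q 0
      head (β ∷ _) = β
      head []      = λ ()

  tail : ∀ {n} → Pt q (suc n) → Pt q n
  tail α i = α (suc i)

  canonical : ∀ {n} → Pt q n → Pt q n
  canonical {zero}  _ = origin
  canonical {suc n} α = cons (α zero) (canonical (tail α))

  canonical-idem : ∀ {n} (α : Pt q n) → canonical (canonical α) ≡ canonical α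
  canonical-idem {zero}  α = ≡.refl
  canonical-idem {suc n} α = ≡.cong (cons (α zero)) (canonical-idem (tail α))

  canonical-pointwise : ∀ {n} (α : Pt q n) i → canonical α i ≡ α i
  canonical-pointwise {suc n} α zero    = ≡.refl
  canonical-pointwise {suc n} α (suc i) = canonical-pointwise (tail α) i

  countB-cong : ∀ n (P P′ : Fin n → Bool) → (∀ i → P i ≡ P′ i) → countB n P ≡ countB n P′
  countB-cong zero    P P′ e = ≡.refl
  countB-cong (suc n) P P′ e = ≡.cong₂ (λ z w → (if z then 1 else 0) ℕ.+ w) (e zero) (countB-cong n _ _ (λ i → e (suc i)))

  allB-cong : ∀ n (P P′ : Fin n → Bool) → (∀ i → P i ≡ P′ i) → allB n P ≡ allB n P′
  allB-cong zero    P P′ e = ≡.refl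
  allB-cong (suc n) P P′ e = ≡.cong₂ _∧_ (e zero) (allB-cong n _ _ (λ i → e (suc i)))

  dist-canonicalˡ : ∀ {n} (α β : Pt q n) → dist (canonical α) β ≡ dist α β
  dist-canonicalˡ {n} α β = countB-cong n _ _ (λ i → ≡.cong (λ z → not ⌊ z ≟ β i ⌋) (canonical-pointwise α i))

  dist-canonicalʳ : ∀ {n} (α β : Pt q n) → dist α (canonical β) ≡ dist α β
  dist-canonicalʳ {n} α β = countB-cong n _ _ (λ i → ≡.cong (λ z → not ⌊ α i ≟ z ⌋) (canonical-pointwise β i))

  inFace-canonical : ∀ {n} (J : Subset n) (α β : Pt q n) → inFace J α (canonical β) ≡ inFace J α β
  inFace-canonical {n} J α β =
    allB-cong n _ _ (λ i → ≡.cong (λ z → if lookup J i then true else ⌊ z ≟ α i ⌋) (canonical-pointwise β i))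

  sumP : (n : ℕ) → (Pt q n → Carrier) → Carrier
  sumP zero    G = G origin
  sumP (suc n) G = sumF (λ b → sumP n (λ β → G (cons b β)))

  sumP-allPts : ∀ n (G : Pt q n → Carrier) → sumR (map G (allPts q n)) ≈ sumP n G
  sumP-allPts zero    G = +-identityʳ _
  sumP-allPts (suc n) G = begin
    sumR (map G (concat (map (λ a → map (cons a) (allPts q n)) (allFin q))))
      ≈⟨ sum-concat G (λ a → map (cons a) (allPts q n)) (allFin q) ⟩
    sumF (λ a → sumR (map G (map (cons a) (allPts q n))))
      ≈⟨ sum-cong _ _ (allFin q) (λ a → trans (reflexive (sum-map G (cons a) (allPts q n))) (sumP-allPts n (λ β → G (cons a β)))) ⟩
    sumF (λ b → sumP n (λ β → G (cons b β))) ∎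

  sumP-cong : ∀ n (G H : Pt q n → Carrier) → (∀ β → G β ≈ H β) → sumP n G ≈ sumP n H
  sumP-cong zero    G H e = e origin
  sumP-cong (suc n) G H e = sum-cong _ _ (allFin q) (λ b → sumP-cong n _ _ (λ β → e (cons b β)))

  sumP-+ : ∀ n (G H : Pt q n → Carrier) → sumP n (λ β → G β + H β) ≈ sumP n G + sumP n H
  sumP-+ zero    G H = refl
  sumP-+ (suc n) G H = trans (sum-cong _ _ (allFin q) (λ b → sumP-+ n _ _)) (sum-+ _ _ (allFin q))

  sumP-*ˡ : ∀ n k (G : Pt q n → Carrier) → sumP n (λ β → k * G β) ≈ k * sumP n G
  sumP-*ˡ zero    k G = refl
  sumP-*ˡ (suc n) k G = trans (sum-cong _ _ (allFin q) (λ b → sumP-*ˡ n k _)) (sum-*ˡ k _ (allFin q))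

  sumP-zero : ∀ n → sumP n (λ _ → 0#) ≈ 0#
  sumP-zero zero    = refl
  sumP-zero (suc n) = trans (sum-cong _ _ (allFin q) (λ b → sumP-zero n)) (sum-zero (allFin q))

  sumP-canonical : ∀ n (G : Pt q n → Carrier) → sumP n (λ β → G (canonical β)) ≈ sumP n G
  sumP-canonical zero    G = refl
  sumP-canonical (suc n) G = sum-cong _ _ (allFin q) (λ b → sumP-canonical n (λ β → G (cons b β)))

  Fun : ℕ → Set c
  Fun n = Pt q n → Carrier

  sumHead : ∀ {n} → Fun (suc n) → Fun n
  sumHead t β = sumF (λ b → t (cons b β))

  -- Adjacency operator of the Hamming graph, (A t)(α) = Σ_{β ∈ W_1(α)} t(β),
  -- by recursion: a neighbour of α either shares its first coordinate and is a
  -- neighbour in the tail, or differs from α in the first coordinate only.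
  adjacency : ∀ n → Fun n → Fun n
  adjacency zero    t α = 0#
  adjacency (suc n) t α =
    adjacency n (λ β → t (cons (α zero) β)) (tail α) + (sumHead t (tail α) - t (cons (α zero) (tail α)))

  -- The S-component of t (an unnormalised Fourier projection): in every
  -- coordinate outside S it takes the sum over that coordinate, in every
  -- coordinate in S it takes q·t minus that sum.
  component : ∀ {n} → Subset n → Fun n → Fun n
  component []          t α = t origin
  component (false ∷ S) t α = component S (sumHead t) (tail α)
  component (true ∷ S)  t α = component S (λ β → natR q * t (cons (α zero) β) - sumHead t β) (tail α)

  record IsLinear (n : ℕ) (O : Fun n → Fun n) : Set (c Level.⊔ ℓ) where
    field
      cong′ : ∀ t s → (∀ β → t β ≈ s β) → ∀ α → O t α ≈ O s α
      +-homo : ∀ t s α → O (λ β → t β + s β) α ≈ O t α + O s α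
      *-homo : ∀ k t α → O (λ β → k * t β) α ≈ k * O t α

    0-homo : ∀ α → O (λ _ → 0#) α ≈ 0#
    0-homo α = trans (cong′ _ _ (λ β → sym (zeroˡ 0#)) α) (trans (*-homo 0# (λ _ → 0#) α) (zeroˡ _))

    -‿homo : ∀ t α → O (λ β → - t β) α ≈ - O t α
    -‿homo t α = trans (cong′ _ _ (λ β → sym (-1*x≈-x (t β))) α) (trans (*-homo (- 1#) t α) (-1*x≈-x _))

    -homo : ∀ t s α → O (λ β → t β - s β) α ≈ O t α - O s α
    -homo t s α = trans (+-homo t (λ β → - s β) α) (+-congˡ (-‿homo s α))

    sum-homo : ∀ (xs : List (Fin q)) (g : Fin q → Fun n) α →
      O (λ β → sumR (map (λ b → g b β) xs)) α ≈ sumR (map (λ b → O (g b) α) xs)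
    sum-homo []       g α = 0-homo α
    sum-homo (x ∷ xs) g α = trans (+-homo (g x) _ α) (+-congˡ (sum-homo xs g α))

    sumF-homo : ∀ (g : Fin q → Fun n) α → O (λ β → sumF (λ b → g b β)) α ≈ sumF (λ b → O (g b) α)
    sumF-homo = sum-homo (allFin q)

  sumHead-cong : ∀ {n} (t s : Fun (suc n)) → (∀ β → t β ≈ s β) → ∀ β → sumHead t β ≈ sumHead s β
  sumHead-cong t s e β = sum-cong _ _ (allFin q) (λ b → e (cons b β))

  sumHead-+ : ∀ {n} (t s : Fun (suc n)) β → sumHead (λ γ → t γ + s γ) β ≈ sumHead t β + sumHead s β
  sumHead-+ t s β = sum-+ _ _ (allFin q)

  sumHead-* : ∀ {n} k (t : Fun (suc n)) β → sumHead (λ γ → k * t γ) β ≈ k * sumHead t β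
  sumHead-* k t β = sum-*ˡ k _ (allFin q)

  component-linear : ∀ {n} (S : Subset n) → IsLinear n (component S)
  component-linear S = record { cong′ = cong′ S ; +-homo = +-homo S ; *-homo = *-homo S }
    where
      cong′ : ∀ {n} (S : Subset n) t s → (∀ β → t β ≈ s β) → ∀ α → component S t α ≈ component S s α
      cong′ []          t s e α = e origin
      cong′ (false ∷ S) t s e α = cong′ S _ _ (sumHead-cong t s e) (tail α)
      cong′ (true ∷ S)  t s e α =
        cong′ S _ _ (λ β → +-cong (*-congˡ (e _)) (-‿cong (sumHead-cong t s e β))) (tail α)

      +-homo : ∀ {n} (S : Subset n) t s α → component S (λ β → t β + s β) α ≈ component S t α + component S s α
      +-homo []          t s α = refl
      +-homo (false ∷ S) t s α = trans (cong′ S _ _ (sumHead-+ t s) (tail α)) (+-homo S _ _ (tail α))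
      +-homo (true ∷ S)  t s α = trans (cong′ S _ _ (λ β → trans (+-congˡ (-‿cong (sumHead-+ t s β)))
          (solve 5 (λ q x y X Y → q :* (x :+ y) :- (X :+ Y) := (q :* x :- X) :+ (q :* y :- Y)) refl (natR q) _ _ _ _)) (tail α))
        (+-homo S _ _ (tail α))

      *-homo : ∀ {n} (S : Subset n) k t α → component S (λ β → k * t β) α ≈ k * component S t α
      *-homo []          k t α = refl
      *-homo (false ∷ S) k t α = trans (cong′ S _ _ (sumHead-* k t) (tail α)) (*-homo S k _ (tail α))
      *-homo (true ∷ S)  k t α = trans (cong′ S _ _ (λ β → trans (+-congˡ (-‿cong (sumHead-* k t β)))
          (solve 4 (λ q k x X → q :* (k :* x) :- (k :* X) := k :* (q :* x :- X)) refl (natR q) k _ _)) (tail α))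
        (*-homo S k _ (tail α))

  adjacency-linear : ∀ n → IsLinear n (adjacency n)
  adjacency-linear n = record { cong′ = cong′ n ; +-homo = +-homo n ; *-homo = *-homo n }
    where
      cong′ : ∀ n t s → (∀ β → t β ≈ s β) → ∀ α → adjacency n t α ≈ adjacency n s α
      cong′ zero    t s e α = refl
      cong′ (suc n) t s e α =
        +-cong (cong′ n _ _ (λ β → e _) (tail α)) (+-cong (sumHead-cong t s e (tail α)) (-‿cong (e _)))

      +-homo : ∀ n t s α → adjacency n (λ β → t β + s β) α ≈ adjacency n t α + adjacency n s α
      +-homo zero    t s α = sym (+-identityʳ 0#)
      +-homo (suc n) t s α = trans (+-cong (+-homo n _ _ (tail α)) (+-congʳ (sumHead-+ t s (tail α))))
        (solve 6 (λ a₁ a₂ T₁ T₂ x y → (a₁ :+ a₂) :+ ((T₁ :+ T₂) :- (x :+ y)) := (a₁ :+ (T₁ :- x)) :+ (a₂ :+ (T₂ :- y)))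
               refl _ _ _ _ _ _)

      *-homo : ∀ n k t α → adjacency n (λ β → k * t β) α ≈ k * adjacency n t α
      *-homo zero    k t α = sym (zeroʳ k)
      *-homo (suc n) k t α = trans (+-cong (*-homo n k _ (tail α)) (+-congʳ (sumHead-* k t (tail α))))
        (solve 4 (λ k a T x → k :* a :+ (k :* T :- k :* x) := k :* (a :+ (T :- x))) refl k _ _ _)

  sumSubsets : ∀ n → (Subset n → Carrier) → Carrier
  sumSubsets zero    G = G []
  sumSubsets (suc n) G = sumSubsets n (λ S → G (false ∷ S)) + sumSubsets n (λ S → G (true ∷ S))

  sumSubsets-cong : ∀ n (G H : Subset n → Carrier) → (∀ S → G S ≈ H S) → sumSubsets n G ≈ sumSubsets n H
  sumSubsets-cong zero    G H e = e []
  sumSubsets-cong (suc n) G H e = +-cong (sumSubsets-cong n _ _ (λ S → e _)) (sumSubsets-cong n _ _ (λ S → e _))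

  sumSubsets-*ˡ : ∀ n k (G : Subset n → Carrier) → k * sumSubsets n G ≈ sumSubsets n (λ S → k * G S)
  sumSubsets-*ˡ zero    k G = refl
  sumSubsets-*ˡ (suc n) k G = trans (distribˡ _ _ _) (+-cong (sumSubsets-*ˡ n k _) (sumSubsets-*ˡ n k _))

  sumSubsets-*ʳ : ∀ n (G : Subset n → Carrier) w → sumSubsets n G * w ≈ sumSubsets n (λ S → G S * w)
  sumSubsets-*ʳ n G w = trans (*-comm _ _) (trans (sumSubsets-*ˡ n w G) (sumSubsets-cong n _ _ (λ S → *-comm _ _)))

  sumP-sumSubsets : ∀ n m (G : Subset m → Fun n) →
    sumP n (λ β → sumSubsets m (λ S → G S β)) ≈ sumSubsets m (λ S → sumP n (G S))
  sumP-sumSubsets n zero    G = refl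
  sumP-sumSubsets n (suc m) G = trans (sumP-+ n _ _) (+-cong (sumP-sumSubsets n m _) (sumP-sumSubsets n m _))

  components-sum : ∀ n (t : Fun n) α → sumSubsets n (λ S → component S t α) ≈ natR (q ℕ.^ n) * t (canonical α)
  components-sum zero    t α = sym (trans (*-congʳ (+-identityʳ 1#)) (*-identityˡ _))
  components-sum (suc n) t α = begin
    sumSubsets n (λ S → component S (sumHead t) (tail α))
      + sumSubsets n (λ S → component S (λ β → natR q * t (cons (α zero) β) - sumHead t β) (tail α))
      ≈⟨ +-cong (components-sum n _ (tail α)) (components-sum n _ (tail α)) ⟩
    natR (q ℕ.^ n) * sumHead t (canonical (tail α))
      + natR (q ℕ.^ n) * (natR q * t (canonical α) - sumHead t (canonical (tail α)))
      ≈⟨ solve 4 (λ N T q x → N :* T :+ N :* (q :* x :- T) := (q :* N) :* x) refl _ _ _ _ ⟩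
    (natR q * natR (q ℕ.^ n)) * t (canonical α)
      ≈⟨ *-congʳ (sym (natR-* q (q ℕ.^ n))) ⟩
    natR (q ℕ.^ suc n) * t (canonical α) ∎

  eigenvalue : ℕ → ℕ → Carrier
  eigenvalue n k = natR (p ℕ.* n) - natR (q ℕ.* k)

  eigenvalue-zero : eigenvalue 0 0 ≈ 0#
  eigenvalue-zero =
    trans (+-cong (reflexive (≡.cong natR (ℕP.*-zeroʳ p))) (-‿cong (reflexive (≡.cong natR (ℕP.*-zeroʳ q)))))
          (-‿inverseʳ 0#)

  eigenvalue-outside : ∀ n k → eigenvalue (suc n) k ≈ eigenvalue n k + natR p
  eigenvalue-outside n k = trans (+-congʳ (trans (reflexive (≡.cong natR (ℕP.*-suc p n))) (natR-+ p _)))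
    (solve 3 (λ s A B → (s :+ A) :- B := (A :- B) :+ s) refl _ _ _)

  eigenvalue-inside : ∀ n k → eigenvalue (suc n) (suc k) ≈ eigenvalue n k - 1#
  eigenvalue-inside n k = trans (+-cong (trans (reflexive (≡.cong natR (ℕP.*-suc p n))) (natR-+ p _))
                                        (-‿cong (trans (reflexive (≡.cong natR (ℕP.*-suc q k))) (natR-+ q _))))
    (solve 4 (λ one s A B → (s :+ A) :- ((one :+ s) :+ B) := (A :- B) :- one) refl 1# (natR p) _ _)

  sumHead-adjacency : ∀ n (t : Fun (suc n)) β →
    sumHead (adjacency (suc n) t) β ≈ adjacency n (sumHead t) β + (natR q * sumHead t β - sumHead t β)
  sumHead-adjacency n t β = begin
    sumF (λ b → adjacency n (λ γ → t (cons b γ)) β + (sumHead t β - t (cons b β)))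
      ≈⟨ sum-+ _ _ (allFin q) ⟩
    sumF (λ b → adjacency n (λ γ → t (cons b γ)) β) + sumF (λ b → sumHead t β - t (cons b β))
      ≈⟨ +-cong (sym (IsLinear.sumF-homo (adjacency-linear n) (λ b γ → t (cons b γ)) β))
                (trans (sum-+ _ _ (allFin q)) (+-cong (sumF-const _) (sum-neg _ (allFin q)))) ⟩
    adjacency n (sumHead t) β + (natR q * sumHead t β - sumHead t β) ∎

  component-eigen : ∀ {n} (S : Subset n) (t : Fun n) α →
    component S (adjacency n t) α ≈ eigenvalue n ∣ S ∣ * component S t α
  component-eigen [] t α = sym (trans (*-congʳ eigenvalue-zero) (zeroˡ _))
  component-eigen {suc n} (false ∷ S) t α = begin
    component S (sumHead (adjacency (suc n) t)) (tail α)
      ≈⟨ IsLinear.cong′ (component-linear S) _ _ (λ β → trans (sumHead-adjacency n t β) (+-congˡ (outside β))) (tail α) ⟩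
    component S (λ β → adjacency n (sumHead t) β + natR p * sumHead t β) (tail α)
      ≈⟨ trans (IsLinear.+-homo (component-linear S) _ _ (tail α))
               (+-cong (component-eigen S (sumHead t) (tail α)) (IsLinear.*-homo (component-linear S) _ _ (tail α))) ⟩
    eigenvalue n ∣ S ∣ * component S (sumHead t) (tail α) + natR p * component S (sumHead t) (tail α)
      ≈⟨ trans (sym (distribʳ _ _ _)) (*-congʳ (sym (eigenvalue-outside n ∣ S ∣))) ⟩
    eigenvalue (suc n) ∣ S ∣ * component S (sumHead t) (tail α) ∎
    where
      outside : ∀ β → natR q * sumHead t β - sumHead t β ≈ natR p * sumHead t β
      outside β = trans (+-congʳ (natR-suc-* p _)) (solve 2 (λ T pT → (T :+ pT) :- T := pT) refl _ _)
  component-eigen {suc n} (true ∷ S) t α = begin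
    component S (λ β → natR q * adjacency (suc n) t (cons a β) - sumHead (adjacency (suc n) t) β) (tail α)
      ≈⟨ IsLinear.cong′ (component-linear S) _ _ (λ β → trans (+-congˡ (-‿cong (sumHead-adjacency n t β))) (inside β)) (tail α) ⟩
    component S (λ β → adjacency n h β - h β) (tail α)
      ≈⟨ trans (IsLinear.-homo (component-linear S) _ _ (tail α)) (+-congʳ (component-eigen S h (tail α))) ⟩
    eigenvalue n ∣ S ∣ * component S h (tail α) - component S h (tail α)
      ≈⟨ trans ([y-z]x≈yx-zx _ _ _) (+-congˡ (-‿cong (*-identityˡ _))) ⟨
    (eigenvalue n ∣ S ∣ - 1#) * component S h (tail α)
      ≈⟨ *-congʳ (sym (eigenvalue-inside n ∣ S ∣)) ⟩
    eigenvalue (suc n) (suc ∣ S ∣) * component S h (tail α) ∎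
    where
      a : Fin q
      a = α zero
      h : Fun n
      h β = natR q * t (cons a β) - sumHead t β
      adjacency-h : ∀ β → adjacency n h β ≈ natR q * adjacency n (λ γ → t (cons a γ)) β - adjacency n (sumHead t) β
      adjacency-h β = trans (IsLinear.-homo (adjacency-linear n) _ _ β) (+-congʳ (IsLinear.*-homo (adjacency-linear n) _ _ β))
      inside : ∀ β → natR q * (adjacency n (λ γ → t (cons a γ)) β + (sumHead t β - t (cons a β)))
                       - (adjacency n (sumHead t) β + (natR q * sumHead t β - sumHead t β))
                     ≈ adjacency n h β - h β
      inside β = trans (solve 5 (λ q A T x AT → q :* (A :+ (T :- x)) :- (AT :+ (q :* T :- T)) := (q :* A :- AT) :- (q :* x :- T))
                              refl (natR q) (adjacency n (λ γ → t (cons a γ)) β) (sumHead t β) (t (cons a β)) (adjacency n (sumHead t) β))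
                       (+-congʳ (sym (adjacency-h β)))

  -- If t is an eigenvector of A for λ_h, its components with |S| ≠ h vanish
  -- (this is where torsion-freeness is needed).
  component-vanishes : TorsionFree → ∀ {n} (S : Subset n) (t : Fun n) h →
    (∀ α → adjacency n t α ≈ eigenvalue n h * t α) → ¬ (∣ S ∣ ≡ h) → ∀ α → component S t α ≈ 0#
  component-vanishes tf {n} S t h eigen |S|≢h α =
    natR-*-injective tf (q ℕ.* ∣ S ∣) (q ℕ.* h) v (λ e → |S|≢h (ℕP.*-cancelˡ-≡ ∣ S ∣ h q e)) q-multiples
    where
      N v : Carrier
      N = natR (p ℕ.* n)
      v = component S t α
      same-eigenvalue : eigenvalue n ∣ S ∣ * v ≈ eigenvalue n h * v
      same-eigenvalue = trans (sym (component-eigen S t α))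
        (trans (IsLinear.cong′ (component-linear S) _ _ eigen α) (IsLinear.*-homo (component-linear S) _ t α))
      q-multiples : natR (q ℕ.* ∣ S ∣) * v ≈ natR (q ℕ.* h) * v
      q-multiples = trans (solve 3 (λ N B c → B :* c := N :* c :- (N :- B) :* c) refl N _ v)
        (trans (+-congˡ (-‿cong same-eigenvalue)) (solve 3 (λ N C c → N :* c :- (N :- C) :* c := C :* c) refl N _ v))

  sum-distance-0 : ∀ n (t : Fun n) α →
    sumP n (λ β → if ⌊ dist α β ℕ.≟ 0 ⌋ then t β else 0#) ≈ t (canonical α)
  sum-distance-0 zero    t α = refl
  sum-distance-0 (suc n) t α =
    trans (sum-cong _ _ (allFin q) by-head) (trans (select′ (α zero) _ (λ _ → 0#)) (select-zero _ (allFin q)))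
    where
      by-head : ∀ b → sumP n (λ β → if ⌊ dist α (cons b β) ℕ.≟ 0 ⌋ then t (cons b β) else 0#)
                      ≈ (if ⌊ α zero ≟ b ⌋ then t (cons b (canonical (tail α))) else 0#)
      by-head b with α zero ≟ b
      ... | yes _ = sum-distance-0 n (λ β → t (cons b β)) (tail α)
      ... | no _  = sumP-zero n

  sum-distance-1 : ∀ n (t : Fun n) → (∀ γ → t (canonical γ) ≈ t γ) → ∀ α →
    sumP n (λ β → if ⌊ dist α β ℕ.≟ 1 ⌋ then t β else 0#) ≈ adjacency n t α
  sum-distance-1 zero    t t-canonical α = refl
  sum-distance-1 (suc n) t t-canonical α = begin
    sumF (λ b → sumP n (λ β → if ⌊ dist α (cons b β) ℕ.≟ 1 ⌋ then t (cons b β) else 0#))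
      ≈⟨ sum-cong _ _ (allFin q) by-head ⟩
    sumF (λ b → if ⌊ a ≟ b ⌋ then adjacency n (λ γ → t (cons b γ)) (tail α) else t (cons b (canonical (tail α))))
      ≈⟨ select′ a _ _ ⟩
    (adjacency n (λ γ → t (cons a γ)) (tail α) - t (cons a (canonical (tail α)))) + sumF (λ b → t (cons b (canonical (tail α))))
      ≈⟨ +-cong (+-congˡ (-‿cong (t-canonical (cons a (tail α))))) (sum-cong _ _ (allFin q) (λ b → t-canonical (cons b (tail α)))) ⟩
    (adjacency n (λ γ → t (cons a γ)) (tail α) - t (cons a (tail α))) + sumHead t (tail α)
      ≈⟨ solve 3 (λ A x T → (A :- x) :+ T := A :+ (T :- x)) refl _ _ _ ⟩
    adjacency (suc n) t α ∎
    where
      a : Fin q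
      a = α zero
      -- a point at distance 1 either shares the head of α or differs only there
      dist-1-cons : ∀ d → ⌊ suc d ℕ.≟ 1 ⌋ ≡ ⌊ d ℕ.≟ 0 ⌋
      dist-1-cons zero    = ≡.refl
      dist-1-cons (suc d) = ≡.refl
      by-head : ∀ b → sumP n (λ β → if ⌊ dist α (cons b β) ℕ.≟ 1 ⌋ then t (cons b β) else 0#)
                      ≈ (if ⌊ a ≟ b ⌋ then adjacency n (λ γ → t (cons b γ)) (tail α) else t (cons b (canonical (tail α))))
      by-head b with a ≟ b
      ... | yes _ = sum-distance-1 n (λ γ → t (cons b γ)) (λ γ → t-canonical (cons b γ)) (tail α)
      ... | no _  = trans (sumP-cong n _ _ (λ β → reflexive (≡.cong (λ z → if z then t (cons b β) else 0#) (dist-1-cons (dist (tail α) β)))))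
                          (sum-distance-0 n (λ γ → t (cons b γ)) (tail α))

  lambda-function-eigen : ∀ {n} (f : Pt q n → Carrier) lam → IsLambdaFunction lam f →
    ∀ α → adjacency n (λ β → f (canonical β)) α ≈ lam * f (canonical α)
  lambda-function-eigen {n} f lam is-lambda α = begin
    adjacency n t α
      ≈⟨ sum-distance-1 n t (λ γ → reflexive (≡.cong f (canonical-idem γ))) α ⟨
    sumP n (λ β → if ⌊ dist α β ℕ.≟ 1 ⌋ then t β else 0#)
      ≈⟨ sumP-cong n _ _ (λ β → reflexive (≡.cong (λ z → if ⌊ z ℕ.≟ 1 ⌋ then t β else 0#)
            (≡.sym (≡.trans (dist-canonicalˡ α (canonical β)) (dist-canonicalʳ α β))))) ⟩
    sumP n (λ β → if ⌊ dist (canonical α) (canonical β) ℕ.≟ 1 ⌋ then f (canonical β) else 0#)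
      ≈⟨ sumP-canonical n _ ⟩
    sumP n (λ β → if ⌊ dist (canonical α) β ℕ.≟ 1 ⌋ then f β else 0#)
      ≈⟨ sumP-allPts n _ ⟨
    sumR (map (λ β → if ⌊ dist (canonical α) β ℕ.≟ 1 ⌋ then f β else 0#) (allPts q n))
      ≈⟨ sum-filter (λ β → dist (canonical α) β ℕ.≟ 1) f (allPts q n) ⟨
    sumR (map f (filter (λ β → dist (canonical α) β ℕ.≟ 1) (allPts q n)))
      ≈⟨ is-lambda (canonical α) ⟩
    lam * f (canonical α) ∎
    where
      t : Fun n
      t β = f (canonical β)

  faceWeight : ∀ {n} → Subset n → Pt q n → Carrier → Carrier → Fun n
  faceWeight J α x y β = if inFace J α β then pow y (dist β α) * pow x (∣ J ∣ ∸ dist β α) else 0#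

  -- faceWeight is a product of per-coordinate factors: a coordinate outside J
  -- must agree with α, a coordinate in J contributes x if it agrees and y if not.
  coordinateWeight : Bool → Fin q → Fin q → Carrier → Carrier → Carrier
  coordinateWeight false a b x y = if ⌊ b ≟ a ⌋ then 1# else 0#
  coordinateWeight true  a b x y = if ⌊ b ≟ a ⌋ then x else y

  face-dist : ∀ {n} (J : Subset n) (α β : Pt q n) → inFace J α β ≡ true → dist β α ≤ ∣ J ∣
  face-dist []      α β e = z≤n
  face-dist (j ∷ J) α β e with β zero ≟ α zero | j
  ... | yes _ | false = face-dist J (tail α) (tail β) e
  ... | yes _ | true  = ℕP.m≤n⇒m≤1+n (face-dist J (tail α) (tail β) e)
  ... | no _  | true  = s≤s (face-dist J (tail α) (tail β) e)
  ... | no _  | false with () ← e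

  faceWeight-cons : ∀ {n} j (J : Subset n) α x y b β →
    faceWeight (j ∷ J) α x y (cons b β) ≈ coordinateWeight j (α zero) b x y * faceWeight J (tail α) x y β
  faceWeight-cons false J α x y b β with b ≟ α zero
  ... | yes _ = sym (*-identityˡ _)
  ... | no _  = sym (zeroˡ _)
  faceWeight-cons true J α x y b β with b ≟ α zero | inFace J (tail α) β in on-face
  ... | no _  | true  = *-assoc _ _ _
  ... | no _  | false = sym (zeroʳ _)
  ... | yes _ | false = sym (zeroʳ _)
  ... | yes _ | true  = trans (*-congˡ (reflexive (≡.cong (pow x) (ℕP.+-∸-assoc 1 (face-dist J (tail α) β on-face)))))
                              (x∙yz≈y∙xz _ x _)

  sumF-*ʳ : ∀ (g : Fin q → Carrier) k → sumF (λ b → g b * k) ≈ sumF g * k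
  sumF-*ʳ g k = trans (sum-cong _ _ (allFin q) (λ b → *-comm _ _)) (trans (sum-*ˡ k g (allFin q)) (*-comm _ _))

  if-*ʳ : ∀ (b : Bool) u v w → (if b then u else v) * w ≈ (if b then u * w else v * w)
  if-*ʳ true  u v w = refl
  if-*ʳ false u v w = refl

  weight-outside : ∀ a (e : Fin q → Carrier) x y → sumF (λ b → coordinateWeight false a b x y * e b) ≈ e a
  weight-outside a e x y = begin
    sumF (λ b → coordinateWeight false a b x y * e b)          ≈⟨ sum-cong _ _ (allFin q) (λ b → if-*ʳ ⌊ b ≟ a ⌋ 1# 0# (e b)) ⟩
    sumF (λ b → if ⌊ b ≟ a ⌋ then 1# * e b else 0# * e b)      ≈⟨ select a _ _ ⟩
    (1# * e a - 0# * e a) + sumF (λ b → 0# * e b)              ≈⟨ +-cong (+-cong (*-identityˡ _) (-‿cong (zeroˡ _))) (sum-cong _ _ (allFin q) (λ b → zeroˡ _)) ⟩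
    (e a - 0#) + sumF (λ _ → 0#)                               ≈⟨ select-zero _ (allFin q) ⟩
    e a                                                        ∎

  weight-inside : ∀ a (e : Fin q → Carrier) x y →
    sumF (λ b → coordinateWeight true a b x y * e b) ≈ (x * e a - y * e a) + y * sumF e
  weight-inside a e x y = trans (sum-cong _ _ (allFin q) (λ b → if-*ʳ ⌊ b ≟ a ⌋ x y (e b)))
                                (trans (select a _ _) (+-congˡ (sum-*ˡ y e (allFin q))))

  inside-part-sum : ∀ {n} (S : Subset n) (t : Fun (suc n)) γ →
    sumF (λ b → component S (λ β → natR q * t (cons b β) - sumHead t β) γ) ≈ 0#
  inside-part-sum S t γ = trans (sym (IsLinear.sumF-homo (component-linear S) _ γ))
    (trans (IsLinear.cong′ (component-linear S) _ _ zero-sum γ) (IsLinear.0-homo (component-linear S) γ))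
    where
      zero-sum : ∀ β → sumF (λ b → natR q * t (cons b β) - sumHead t β) ≈ 0#
      zero-sum β = trans (sum-+ _ _ (allFin q))
        (trans (+-cong (sum-*ˡ (natR q) _ (allFin q)) (trans (sum-neg _ (allFin q)) (-‿cong (sumF-const _))))
               (-‿inverseʳ _))

  component-enumerator : ∀ {n} (S J : Subset n) (t : Fun n) α x y →
    sumP n (λ β → component S t β * faceWeight J α x y β)
      ≈ component S t (canonical α) * (pow (x + natR p * y) ∣ J ─ S ∣ * pow (x - y) ∣ J ∩ S ∣)
  component-enumerator []      []      t α x y = refl
  component-enumerator {suc n} (s ∷ S) (j ∷ J) t α x y = trans (sum-by-head s j) (by-cases s j)
    where
      a : Fin q
      a = α zero
      u U : Carrier
      u = x + natR p * y
      U = pow u ∣ J ─ S ∣ * pow (x - y) ∣ J ∩ S ∣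
      part : Bool → Fin q → Fun n
      part false b = sumHead t
      part true  b β = natR q * t (cons b β) - sumHead t β
      E : Bool → Fin q → Carrier
      E s b = component S (part s b) (canonical (tail α)) * U

      pull : ∀ w (g : Fun n) → sumP n (λ β → component S g β * (w * faceWeight J (tail α) x y β))
                               ≈ w * (component S g (canonical (tail α)) * U)
      pull w g = trans (sumP-cong n _ _ (λ β → x∙yz≈y∙xz _ _ _))
                       (trans (sumP-*ˡ n _ _) (*-congˡ (component-enumerator S J g (tail α) x y)))

      sum-by-head : ∀ s j → sumP (suc n) (λ β → component (s ∷ S) t β * faceWeight (j ∷ J) α x y β)
                            ≈ sumF (λ b → coordinateWeight j a b x y * E s b)
      sum-by-head s j = sum-cong _ _ (allFin q) (λ b →
          trans (sumP-cong n _ _ (λ β → *-congˡ (faceWeight-cons j J α x y b β))) (by-part s b))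
        where
          by-part : ∀ s b → sumP n (λ β → component (s ∷ S) t (cons b β) * (coordinateWeight j a b x y * faceWeight J (tail α) x y β))
                            ≈ coordinateWeight j a b x y * E s b
          by-part false b = pull _ (part false b)
          by-part true  b = pull _ (part true b)

      by-cases : ∀ s j → sumF (λ b → coordinateWeight j a b x y * E s b)
                         ≈ component (s ∷ S) t (canonical α) * (pow u ∣ (j ∷ J) ─ (s ∷ S) ∣ * pow (x - y) ∣ (j ∷ J) ∩ (s ∷ S) ∣)
      by-cases false false = weight-outside a (E false) x y
      by-cases true  false = weight-outside a (E true) x y
      by-cases false true  = trans (weight-inside a (E false) x y)
        (trans (+-congˡ (*-congˡ (trans (sumF-const _) (natR-suc-* p _))))
          (solve 6 (λ x y p c A B → (x :* (c :* (A :* B)) :- y :* (c :* (A :* B))) :+ y :* (c :* (A :* B) :+ p :* (c :* (A :* B)))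
                                    := c :* (((x :+ p :* y) :* A) :* B)) refl x y (natR p) _ _ _))
      by-cases true  true  = trans (weight-inside a (E true) x y)
        (trans (+-congˡ (trans (*-congˡ (trans (sumF-*ʳ _ U) (trans (*-congʳ (inside-part-sum S t (canonical (tail α)))) (zeroˡ U))))
                               (zeroʳ y)))
          (trans (+-identityʳ _)
            (solve 5 (λ x y c A B → x :* (c :* (A :* B)) :- y :* (c :* (A :* B)) := c :* (A :* ((x :- y) :* B))) refl x y _ _ _)))

  localWE-as-sum : ∀ {n} (f : Pt q n → Carrier) J α x y →
    localWE f J α x y ≈ sumP n (λ β → f (canonical β) * faceWeight J α x y β)
  localWE-as-sum {n} f J α x y = begin
    localWE f J α x y
      ≈⟨ sum-filter (λ β → inFace J α β Data.Bool.≟ true) G (allPts q n) ⟩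
    sumR (map (λ β → if ⌊ inFace J α β Data.Bool.≟ true ⌋ then G β else 0#) (allPts q n))
      ≈⟨ sumP-allPts n _ ⟩
    sumP n (λ β → if ⌊ inFace J α β Data.Bool.≟ true ⌋ then G β else 0#)
      ≈⟨ sumP-canonical n _ ⟨
    sumP n (λ β → if ⌊ inFace J α (canonical β) Data.Bool.≟ true ⌋ then G (canonical β) else 0#)
      ≈⟨ sumP-cong n _ _ (λ β → masked β (inFace J α β) ≡.refl) ⟩
    sumP n (λ β → f (canonical β) * faceWeight J α x y β) ∎
    where
      G : Pt q n → Carrier
      G β = f β * pow y (dist β α) * pow x (∣ J ∣ ∸ dist β α)
      masked : ∀ β (b : Bool) → inFace J α β ≡ b →
        (if ⌊ inFace J α (canonical β) Data.Bool.≟ true ⌋ then G (canonical β) else 0#) ≈ f (canonical β) * faceWeight J α x y β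
      masked β true  e rewrite inFace-canonical J α β | dist-canonicalˡ β α | e = *-assoc _ _ _
      masked β false e rewrite inFace-canonical J α β | dist-canonicalˡ β α | e = sym (zeroʳ _)

  localWE-decomposition : ∀ {n} (f : Pt q n → Carrier) J α x y →
    natR (q ℕ.^ n) * localWE f J α x y
      ≈ sumSubsets n (λ S → component S (λ β → f (canonical β)) (canonical α)
                                * (pow (x + natR p * y) ∣ J ─ S ∣ * pow (x - y) ∣ J ∩ S ∣))
  localWE-decomposition {n} f J α x y = begin
    natR (q ℕ.^ n) * localWE f J α x y
      ≈⟨ *-congˡ (localWE-as-sum f J α x y) ⟩
    natR (q ℕ.^ n) * sumP n (λ β → t β * faceWeight J α x y β)
      ≈⟨ sumP-*ˡ n _ _ ⟨
    sumP n (λ β → natR (q ℕ.^ n) * (t β * faceWeight J α x y β))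
      ≈⟨ sumP-cong n _ _ (λ β → trans (sym (*-assoc _ _ _)) (*-congʳ (decompose β))) ⟩
    sumP n (λ β → sumSubsets n (λ S → component S t β) * faceWeight J α x y β)
      ≈⟨ sumP-cong n _ _ (λ β → sumSubsets-*ʳ n _ _) ⟩
    sumP n (λ β → sumSubsets n (λ S → component S t β * faceWeight J α x y β))
      ≈⟨ sumP-sumSubsets n n (λ S β → component S t β * faceWeight J α x y β) ⟩
    sumSubsets n (λ S → sumP n (λ β → component S t β * faceWeight J α x y β))
      ≈⟨ sumSubsets-cong n _ _ (λ S → component-enumerator S J t α x y) ⟩
    sumSubsets n (λ S → component S t (canonical α) * (pow (x + natR p * y) ∣ J ─ S ∣ * pow (x - y) ∣ J ∩ S ∣)) ∎
    where
      t : Fun n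
      t β = f (canonical β)
      decompose : ∀ β → natR (q ℕ.^ n) * t β ≈ sumSubsets n (λ S → component S t β)
      decompose β = trans (*-congˡ (reflexive (≡.cong f (≡.sym (canonical-idem β))))) (sym (components-sum n t β))

  -- Exponent matching for a component with |S| = h: with k = |I|, k̄ = |∁I|,
  --   u^{h-k̄} v^{k-h} · c · u^{|∁I∖S|} v^{|∁I∩S|} = v^{h-k} u^{k̄-h} · c · v^{|I∖S|} u^{|I∩S|},
  -- since both sides equal c · u^{max(h,k̄) - |∁I∩S|} · v^{max(h,k) - |I∩S|}.
  same-monomials : ∀ {n} (I S : Subset n) h → ∣ S ∣ ≡ h → ∀ u v c →
    pow u (h ∸ ∣ ∁ I ∣) * pow v (∣ I ∣ ∸ h) * (c * (pow u ∣ ∁ I ─ S ∣ * pow v ∣ ∁ I ∩ S ∣))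
      ≈ pow v (h ∸ ∣ I ∣) * pow u (∣ ∁ I ∣ ∸ h) * (c * (pow v ∣ I ─ S ∣ * pow u ∣ I ∩ S ∣))
  same-monomials I S h |S|≡h u v c = begin
    pow u (h ∸ k̄) * pow v (k ∸ h) * (c * (pow u a₁ * pow v b₁))
      ≈⟨ solve 5 (λ U V c A B → U :* V :* (c :* (A :* B)) := c :* ((U :* A) :* (V :* B))) refl _ _ _ _ _ ⟩
    c * ((pow u (h ∸ k̄) * pow u a₁) * (pow v (k ∸ h) * pow v b₁))
      ≈⟨ *-congˡ (*-cong (pow-+ u (h ∸ k̄) a₁) (pow-+ v (k ∸ h) b₁)) ⟨
    c * (pow u ((h ∸ k̄) ℕ.+ a₁) * pow v ((k ∸ h) ℕ.+ b₁))
      ≈⟨ reflexive (≡.cong₂ (λ i j → c * (pow u i * pow v j)) u-exponent v-exponent) ⟩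
    c * (pow u ((k̄ ∸ h) ℕ.+ b₂) * pow v ((h ∸ k) ℕ.+ a₂))
      ≈⟨ *-congˡ (*-cong (pow-+ u (k̄ ∸ h) b₂) (pow-+ v (h ∸ k) a₂)) ⟩
    c * ((pow u (k̄ ∸ h) * pow u b₂) * (pow v (h ∸ k) * pow v a₂))
      ≈⟨ solve 5 (λ U V c A B → c :* ((U :* B) :* (V :* A)) := V :* U :* (c :* (A :* B))) refl _ _ _ _ _ ⟩
    pow v (h ∸ k) * pow u (k̄ ∸ h) * (c * (pow v a₂ * pow u b₂)) ∎
    where
      k k̄ a₁ b₁ a₂ b₂ : ℕ
      k  = ∣ I ∣
      k̄  = ∣ ∁ I ∣
      a₁ = ∣ ∁ I ─ S ∣
      b₁ = ∣ ∁ I ∩ S ∣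
      a₂ = ∣ I ─ S ∣
      b₂ = ∣ I ∩ S ∣
      b₁+b₂≡h : b₁ ℕ.+ b₂ ≡ h
      b₁+b₂≡h = ≡.trans (complement-split I S) |S|≡h
      u-exponent : (h ∸ k̄) ℕ.+ a₁ ≡ (k̄ ∸ h) ℕ.+ b₂
      u-exponent = ≡.subst₂ (λ h k̄ → (h ∸ k̄) ℕ.+ a₁ ≡ (k̄ ∸ h) ℕ.+ b₂) b₁+b₂≡h (split-size (∁ I) S)
                            (exponent-balance a₁ b₁ b₂)
      v-exponent : (k ∸ h) ℕ.+ b₁ ≡ (h ∸ k) ℕ.+ a₂
      v-exponent = ≡.subst₂ (λ h k → (k ∸ h) ℕ.+ b₁ ≡ (h ∸ k) ℕ.+ a₂) b₁+b₂≡h (≡.trans (ℕP.+-comm b₂ a₂) (split-size I S))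
                            (exponent-balance b₁ b₂ a₂)

  -- The identity holds componentwise: components with |S| ≠ h vanish, and
  -- the others have matching monomials.
  component-identity : TorsionFree → ∀ {n} (t : Fun n) h → (∀ α → adjacency n t α ≈ eigenvalue n h * t α) →
    ∀ (I S : Subset n) γ u v →
    pow u (h ∸ ∣ ∁ I ∣) * pow v (∣ I ∣ ∸ h) * (component S t γ * (pow u ∣ ∁ I ─ S ∣ * pow v ∣ ∁ I ∩ S ∣))
      ≈ pow v (h ∸ ∣ I ∣) * pow u (∣ ∁ I ∣ ∸ h) * (component S t γ * (pow v ∣ I ─ S ∣ * pow u ∣ I ∩ S ∣))
  component-identity tf t h eigen I S γ u v with ∣ S ∣ ℕ.≟ h
  ... | yes |S|≡h = same-monomials I S h |S|≡h u v _
  ... | no  |S|≢h = trans (vanish _ _) (sym (vanish _ _))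
    where
      vanish : ∀ A B → A * (component S t γ * B) ≈ 0#
      vanish A B = trans (*-congˡ (trans (*-congʳ (component-vanishes tf S t h eigen |S|≢h γ)) (zeroˡ B))) (zeroʳ A)

  scaled-expansion : ∀ {n} (f : Pt q n → Carrier) J α x y A →
    natR (q ℕ.^ n) * (A * localWE f J α x y)
      ≈ sumSubsets n (λ S → A * (component S (λ β → f (canonical β)) (canonical α)
                                   * (pow (x + natR p * y) ∣ J ─ S ∣ * pow (x - y) ∣ J ∩ S ∣)))
  scaled-expansion {n} f J α x y A =
    trans (x∙yz≈y∙xz _ _ _) (trans (*-congˡ (localWE-decomposition f J α x y)) (sumSubsets-*ˡ n A _))

  -- The theorem for general q = p + 1 and any (x′, y′) related to (x, y) by
  -- x′ + (q-1)y′ = x - y and x′ - y′ = x + (q-1)y.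
  duality : TorsionFree → ∀ n h (f : Pt q n → Carrier) → IsLambdaFunction (eigenvalue n h) f →
    ∀ α (I : Subset n) x y x′ y′ → x′ + natR p * y′ ≈ x - y → x′ - y′ ≈ x + natR p * y →
    pow (x + natR p * y) (h ∸ ∣ ∁ I ∣) * pow (x′ + natR p * y′) (∣ I ∣ ∸ h) * localWE f (∁ I) α x y
      ≈ pow (x′ + natR p * y′) (h ∸ ∣ I ∣) * pow (x + natR p * y) (∣ ∁ I ∣ ∸ h) * localWE f I α x′ y′
  duality tf n h f is-lambda α I x y x′ y′ v≈x-y x′-y′≈u =
    natR-*-cancel tf (q ℕ.^ n) {{ℕP.m^n≢0 q n}} (begin
      natR (q ℕ.^ n) * (A * localWE f (∁ I) α x y)
        ≈⟨ scaled-expansion f (∁ I) α x y A ⟩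
      sumSubsets n (λ S → A * (comp S * (pow u ∣ ∁ I ─ S ∣ * pow (x - y) ∣ ∁ I ∩ S ∣)))
        ≈⟨ sumSubsets-cong n _ _ (λ S → *-congˡ (*-congˡ (*-congˡ (pow-cong ∣ ∁ I ∩ S ∣ (sym v≈x-y))))) ⟩
      sumSubsets n (λ S → A * (comp S * (pow u ∣ ∁ I ─ S ∣ * pow v ∣ ∁ I ∩ S ∣)))
        ≈⟨ sumSubsets-cong n _ _ (λ S → component-identity tf t h eigen I S (canonical α) u v) ⟩
      sumSubsets n (λ S → B * (comp S * (pow v ∣ I ─ S ∣ * pow u ∣ I ∩ S ∣)))
        ≈⟨ sumSubsets-cong n _ _ (λ S → *-congˡ (*-congˡ (*-congˡ (pow-cong ∣ I ∩ S ∣ (sym x′-y′≈u))))) ⟩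
      sumSubsets n (λ S → B * (comp S * (pow v ∣ I ─ S ∣ * pow (x′ - y′) ∣ I ∩ S ∣)))
        ≈⟨ scaled-expansion f I α x′ y′ B ⟨
      natR (q ℕ.^ n) * (B * localWE f I α x′ y′) ∎)
    where
      u v A B : Carrier
      u = x + natR p * y
      v = x′ + natR p * y′
      A = pow u (h ∸ ∣ ∁ I ∣) * pow v (∣ I ∣ ∸ h)
      B = pow v (h ∸ ∣ I ∣) * pow u (∣ ∁ I ∣ ∸ h)
      t : Fun n
      t β = f (canonical β)
      comp : Subset n → Carrier
      comp S = component S t (canonical α)
      eigen : ∀ γ → adjacency n t γ ≈ eigenvalue n h * t γ
      eigen = lambda-function-eigen f (eigenvalue n h) is-lambda

theorem1 : ∀ {c ℓ : Level} (R : CommutativeRing c ℓ) →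
    let open CommutativeRing R
        open WithRing R
    in TorsionFree →
       (q n h : ℕ) → 2 ≤ q → 1 ≤ n → h ≤ n →
       (f : Pt q n → Carrier) →
       IsLambdaFunction (natR ((q ∸ 1) *ℕ n) - natR (q *ℕ h)) f →
       (α : Pt q n) (I : Subset n) (x y : Carrier) →
       let x′ = x + natR (q ∸ 2) * y
           y′ = - y
           u = x + natR (q ∸ 1) * y
           v = x′ + natR (q ∸ 1) * y′
           k = ∣ I ∣
           k̄ = ∣ ∁ I ∣
       in pow u (h ∸ k̄) * pow v (k ∸ h) * localWE f (∁ I) α x y
          ≈ pow v (h ∸ k) * pow u (k̄ ∸ h) * localWE f I α x′ y′
theorem1 R tf .(suc (suc r)) n h (s≤s (s≤s {n = r} z≤n)) _ _ f is-lambda α I x y =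
  Hypercube.duality R (suc r) tf n h f is-lambda α I x y (x + natR r * y) (- y)
    (substitution-sum r x y) (substitution-difference r x y)
  where
    open CommutativeRing R
    open WithRing R
    open RingArithmetic R
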